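{- Consider the generalized Sudoku problem with data $n, \pi_1, \pi_2, \pi_3, i_1, \ldots, i_k, g_{i_1}, \ldots, g_{i_k}$ and solution set $S(n,g)$, and let $x \in S(n, g)$. Then $x$ is the unique solution (i.e., $S(n,g) = \{x\}$) if and only if there does not exist a permutation $\tau$ of $\{1, \ldots, n^2\}$ such that $\tau(x) \ne x$, $\tau$ is $\pi_1$-consistent, $\pi_2$-$x$-consistent and $\pi_3$-$x$-consistent, and $\tau(i_l) = i_l$ for $l = 1, \ldots, k$.
   Context: For $y \in \mathbb{Z}^s$ write $y <> \mathbf{0}$ if every component of $y$ is nonzero. Let $n \ge 2$ and $s(n) = \sum_{i=1}^{n-1} i$. The $s(n) \times n$ matrix $A(n)$ is defined inductively: $A(1)$ is the empty matrix, and $A(m) = \begin{pmatrix} \mathbf{1}_{m-1} & -U_{m-1} \\ \mathbf{0}_{s(m-1)} & A(m-1) \end{pmatrix}$, where $\mathbf{1}_{m-1}$ is the all-ones column, $U_{m-1}$ the identity matrix and $\mathbf{0}_{s(m-1)}$ the zero column of length $s(m-1)$. Let $A$ be the $(n \cdot s(n)) \times n^2$ block-diagonal matrix whose $n$ diagonal blocks all equal $A(n)$. For a permutation $\pi$ of $\{1,\ldots,n^2\}$, $A_\pi$ is the matrix whose $j$-th column is the $\pi^{ -1}(j)$-th column of $A$. For a permutation $\tau$ and $x \in \mathbb{Z}^{n^2}$, $\tau(x) = (x_{\tau^{ -1}(1)}, \ldots, x_{\tau^{ -1}(n^2)})^T$. The constraint sets of $\pi$ are $cs_\pi(j) = \{\pi(i)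 \mid (j-1)n + 1 \le i \le jn\}$, $j=1,\ldots,n$. A permutation $\tau$ is $\pi$-consistent if $\tau(cs_\pi(j)) = cs_\pi(j)$ for all $j$, and $\pi$-$x$-consistent if $\{x_{\tau^{ -1}(i)} \mid i \in cs_\pi(j)\} = \{x_i \mid i \in cs_\pi(j)\}$ for all $j$. Generalized Sudoku problem: given permutations $\pi_1, \pi_2, \pi_3$ of $\{1, \ldots, n^2\}$, an integer $0 \le k \le n^2$, an index set $\{i_1, \ldots, i_k\} \subset \{1, \ldots, n^2\}$ and givens $g_{i_l} \in \mathbb{Z}$ with $1 \le g_{i_l} \le n$, its solution set is $S(n,g) = \{x \in \mathbb{Z}^{n^2} \mid 1 \le x_i \le n \ (i = 1,\ldots,n^2),\ A_{\pi_r}x <> \mathbf{0}\ (r = 1,2,3),\ x_{i_l} = g_{i_l}\ (l = 1, \ldots, k)\}$. -}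

module Defs where

open import Data.Nat using (ℕ; zero; suc; _*_) renaming (_+_ to _+ℕ_)
open import Data.Integer using (ℤ; +_; -_; _+_; _≤_) renaming (_*_ to _*ℤ_)
open import Data.Fin using (Fin; zero; suc; splitAt; remQuot; quotient)
open import Data.Fin.Permutation using (Permutation′; _⟨$⟩ʳ_; _⟨$⟩ˡ_)
open import Data.Product using (_×_; _,_; ∃-syntax)
open import Data.Sum using (inj₁; inj₂)
open import Relation.Binary.PropositionalEquality using (_≡_; _≢_)
open import Relation.Nullary using (¬_; yes; no)
open import Function.Bundles using (_⇔_)
open import Data.Fin using (_≟_)

s : ℕ → ℕ
s zero = 0
s (suc m) = m +ℕ s m

-- matrices as functions, vectors as functions (indices 0-based)
Matrix : ℕ → ℕ → Set
Matrix r c = Fin r → Fin c → ℤ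

Vector : ℕ → Set
Vector m = Fin m → ℤ

δ : ∀ {m} → Fin m → Fin m → ℤ
δ i j with i ≟ j
... | yes _ = + 1
... | no _ = + 0

-- A(m), the s(m) × m matrix defined inductively:
-- A(m) = ( 1_{m-1}  -U_{m-1} ; 0_{s(m-1)}  A(m-1) ), A(1) (and A(0)) empty.
Am : (m : ℕ) → Matrix (s m) m
Am zero () c
Am (suc m) r c with splitAt m r | c
... | inj₁ _ | zero = + 1
... | inj₁ t | suc j = - δ t j
... | inj₂ _ | zero = + 0
... | inj₂ t | suc j = Am m t j

-- block-diagonal (n·s(n)) × n² matrix with n copies of A(n)
-- (row (b-1)s(n)+r of block b, column (b'-1)n+c of block b')
Ablock : (n : ℕ) → Matrix (n * s n) (n * n)
Ablock n r c with remQuot {n} (s n) r | remQuot {n} n c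
... | (b , r′) | (b′ , c′) with b ≟ b′
...   | yes _ = Am n r′ c′
...   | no _ = + 0

Aπ : (n : ℕ) → Permutation′ (n * n) → Matrix (n * s n) (n * n)
Aπ n π r j = Ablock n r (π ⟨$⟩ˡ j)

sumF : (m : ℕ) → (Fin m → ℤ) → ℤ
sumF zero f = + 0
sumF (suc m) f = f zero + sumF m (λ i → f (suc i))

_·_ : ∀ {r c} → Matrix r c → Vector c → Vector r
_·_ {r} {c} M x i = sumF c (λ j → M i j *ℤ x j)

_<>0 : ∀ {m} → Vector m → Set
y <>0 = ∀ i → ¬ (y i ≡ + 0)

-- Data of a generalized Sudoku problem: n, π₁ π₂ π₃, k, indices ι(l) = i_l
-- (pairwise distinct), givens g(l) = g_{i_l}.
-- Solution set S(n,g) as a predicate on ℤ^{n²}.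
InS : (n : ℕ) (π₁ π₂ π₃ : Permutation′ (n * n)) (k : ℕ)
      (ι : Fin k → Fin (n * n)) (g : Fin k → ℤ) → Vector (n * n) → Set
InS n π₁ π₂ π₃ k ι g x =
  (∀ i → (+ 1 ≤ x i) × (x i ≤ + n)) ×
  (Aπ n π₁ · x) <>0 × (Aπ n π₂ · x) <>0 × (Aπ n π₃ · x) <>0 ×
  (∀ l → x (ι l) ≡ g l)

-- membership in the constraint set cs_π(j) = { π(i) | i in block j }
_∈cs[_,_] : ∀ {n} → Fin (n * n) → Permutation′ (n * n) → Fin n → Set
_∈cs[_,_] {n} y π j = ∃[ i ] (quotient {n} n i ≡ j × π ⟨$⟩ʳ i ≡ y)

πConsistent : ∀ {n} → Permutation′ (n * n) → Permutation′ (n * n) → Set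
πConsistent {n} π τ = ∀ (j : Fin n) (y : Fin (n * n)) →
  (∃[ i ] (i ∈cs[ π , j ] × τ ⟨$⟩ʳ i ≡ y)) ⇔ (y ∈cs[ π , j ])

πxConsistent : ∀ {n} → Permutation′ (n * n) → Vector (n * n) →
               Permutation′ (n * n) → Set
πxConsistent {n} π x τ = ∀ (j : Fin n) (v : ℤ) →
  (∃[ i ] (i ∈cs[ π , j ] × x (τ ⟨$⟩ˡ i) ≡ v)) ⇔
  (∃[ i ] (i ∈cs[ π , j ] × x i ≡ v))

actP : ∀ {m} → Permutation′ m → Vector m → Vector m
actP τ x i = x (τ ⟨$⟩ˡ i)

module Submission where

-- The key observation is that, for x with entries in {1,…,n}, the condition
-- A_π x <> 0 says exactly that every constraint set of π carries every symbol
-- once: row (j, r) of A_π x is row r of A(n) applied to the entries on the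
-- j-th constraint set, and A(m) z <> 0 iff z is injective; for n symbols in n
-- places, injective and covering are equivalent by the pigeonhole principle.
-- Hence (1) a symmetry τ of x maps x to another solution τ(x), and (2) any
-- solution y is τ(x) for the symmetry τ that rearranges each constraint set of
-- π₁ so as to match x with y; such a τ fixes every cell where x and y agree,
-- in particular the givens.

open import Defs
open import Data.Nat as ℕ using (ℕ; zero; suc; _*_; _≤_) renaming (_+_ to _+ℕ_)
import Data.Nat.Properties as ℕP
open import Data.Integer as ℤ using (ℤ; +_; -_; _+_; _-_) renaming (_*_ to _*ℤ_; _≤_ to _≤ℤ_)
import Data.Integer.Properties as ℤP
open import Data.Fin as Fin using (Fin; zero; suc; toℕ; fromℕ<; punchOut; _↑ˡ_; _↑ʳ_; combine; remQuot; splitAt)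
import Data.Fin.Properties as FinP
open import Data.Fin.Permutation using (Permutation′; _⟨$⟩ʳ_; _⟨$⟩ˡ_; inverseˡ; inverseʳ; permutation)
open import Data.Product using (_×_; _,_; ∃-syntax; proj₁; proj₂)
open import Data.Sum using (inj₁; inj₂)
open import Data.Empty using (⊥-elim)
open import Relation.Nullary using (¬_; yes; no)
open import Relation.Nullary.Decidable using (decidable-stable)
open import Relation.Binary.PropositionalEquality
open import Function.Base using (_∘_)
open import Function.Definitions using (Injective)
open import Function.Bundles using (_⇔_; mk⇔; Equivalence)
import Algebra.Properties.CommutativeMonoid.Sum as MonoidSum

-- An injective endomap of a finite set is surjective: otherwise, punching
-- out a missed value would inject Fin (suc m) into Fin m.
injective⇒surjective : ∀ {n} (f : Fin n → Fin n) → Injective _≡_ _≡_ f →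
                       ∀ v → ∃[ c ] (f c ≡ v)
injective⇒surjective {suc m} f f-inj v with FinP.any? (λ c → f c Fin.≟ v)
... | yes hit = hit
... | no miss = ⊥-elim (ℕP.<-irrefl refl (FinP.injective⇒≤ squeeze-inj))
  where
  avoids : ∀ c → v ≢ f c
  avoids c v≡fc = miss (c , sym v≡fc)
  squeeze-inj : Injective _≡_ _≡_ (λ c → punchOut (avoids c))
  squeeze-inj {a} {b} eq = f-inj (FinP.punchOut-injective (avoids a) (avoids b) eq)

-- A surjective endomap of a finite set is injective: a right inverse of it
-- is injective, hence surjective, so f is determined by it.
surjective⇒injective : ∀ {n} (f : Fin n → Fin n) → (∀ v → ∃[ c ] (f c ≡ v)) →
                       Injective _≡_ _≡_ f
surjective⇒injective {n} f f-surj {a} {b} fa≡fb = begin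
  a            ≡⟨ preimage a ⟨
  g a′         ≡⟨ cong g a′≡b′ ⟩
  g b′         ≡⟨ preimage b ⟩
  b            ∎
  where
  open ≡-Reasoning
  g : Fin n → Fin n
  g v = proj₁ (f-surj v)
  f∘g : ∀ v → f (g v) ≡ v
  f∘g v = proj₂ (f-surj v)
  g-surj : ∀ c → ∃[ v ] (g v ≡ c)
  g-surj = injective⇒surjective g (λ {u} {w} gu≡gw →
    trans (sym (f∘g u)) (trans (cong f gu≡gw) (f∘g w)))
  a′ b′ : Fin n
  a′ = proj₁ (g-surj a)
  b′ = proj₁ (g-surj b)
  preimage : ∀ c → g (proj₁ (g-surj c)) ≡ c
  preimage c = proj₂ (g-surj c)
  a′≡b′ : a′ ≡ b′
  a′≡b′ = begin
    a′           ≡⟨ f∘g a′ ⟨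
    f (g a′)     ≡⟨ cong f (preimage a) ⟩
    f a          ≡⟨ fa≡fb ⟩
    f b          ≡⟨ cong f (preimage b) ⟨
    f (g b′)     ≡⟨ f∘g b′ ⟩
    b′           ∎

Symbol : ℕ → ℤ → Set
Symbol n v = (+ 1 ≤ℤ v) × (v ≤ℤ + n)

Covers : ∀ n → (Fin n → ℤ) → Set
Covers n z = ∀ v → Symbol n v → ∃[ c ] (z c ≡ v)

symbol : ∀ {n} → Fin n → ℤ
symbol k = + suc (toℕ k)

symbol-injective : ∀ {n} → Injective _≡_ _≡_ (symbol {n})
symbol-injective eq = FinP.toℕ-injective (ℕP.suc-injective (ℤP.+-injective eq))

symbol-surjective : ∀ {n} v → Symbol n v → ∃[ k ] (symbol {n} k ≡ v)
symbol-surjective (+ suc m) (_ , ℤ.+≤+ m<n) = fromℕ< m<n , cong (λ t → + suc t) (FinP.toℕ-fromℕ< m<n)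
symbol-surjective (+ zero) (ℤ.+≤+ () , _)

symbol-isSymbol : ∀ {n} (k : Fin n) → Symbol n (symbol k)
symbol-isSymbol k = ℤ.+≤+ (ℕ.s≤s ℕ.z≤n) , ℤ.+≤+ (FinP.toℕ<n k)

-- For n symbols, being pairwise distinct and using every symbol are
-- equivalent: read through the enumeration, this is the pigeonhole
-- principle for endomaps of Fin n.
module _ {n} {z : Fin n → ℤ} (z-symbols : ∀ c → Symbol n (z c)) where

  private
    index : Fin n → Fin n
    index c = proj₁ (symbol-surjective (z c) (z-symbols c))

    symbol∘index : ∀ c → symbol (index c) ≡ z c
    symbol∘index c = proj₂ (symbol-surjective (z c) (z-symbols c))

  injective⇒covers : Injective _≡_ _≡_ z → Covers n z
  injective⇒covers z-inj v v-symbol = c , (begin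
    z c                 ≡⟨ symbol∘index c ⟨
    symbol (index c)    ≡⟨ cong symbol (proj₂ hit) ⟩
    symbol k            ≡⟨ proj₂ (symbol-surjective v v-symbol) ⟩
    v                   ∎)
    where
    open ≡-Reasoning
    k : Fin n
    k = proj₁ (symbol-surjective v v-symbol)
    index-inj : Injective _≡_ _≡_ index
    index-inj eq = z-inj (trans (sym (symbol∘index _)) (trans (cong symbol eq) (symbol∘index _)))
    hit : ∃[ c ] (index c ≡ k)
    hit = injective⇒surjective index index-inj k
    c : Fin n
    c = proj₁ hit

  covers⇒injective : Covers n z → Injective _≡_ _≡_ z
  covers⇒injective z-covers {a} {b} za≡zb = surjective⇒injective index index-surj
    (symbol-injective (trans (symbol∘index a) (trans za≡zb (sym (symbol∘index b)))))
    where
    index-surj : ∀ k → ∃[ c ] (index c ≡ k)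
    index-surj k with z-covers (symbol k) (symbol-isSymbol k)
    ... | c , zc≡k = c , symbol-injective (trans (symbol∘index c) zc≡k)

module ℤSum = MonoidSum ℤP.+-0-commutativeMonoid

sumF-cong : ∀ m {f g : Fin m → ℤ} → (∀ i → f i ≡ g i) → sumF m f ≡ sumF m g
sumF-cong zero    f≗g = refl
sumF-cong (suc m) f≗g = cong₂ _+_ (f≗g zero) (sumF-cong m (λ i → f≗g (suc i)))

sumF-zero : ∀ m {f : Fin m → ℤ} → (∀ i → f i ≡ + 0) → sumF m f ≡ + 0
sumF-zero zero    f≗0 = refl
sumF-zero (suc m) f≗0 = cong₂ _+_ (f≗0 zero) (sumF-zero m (λ i → f≗0 (suc i)))

sumF≡sum : ∀ m (f : Fin m → ℤ) → sumF m f ≡ ℤSum.sum f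
sumF≡sum zero    f = refl
sumF≡sum (suc m) f = cong (_+_ (f zero)) (sumF≡sum m (λ i → f (suc i)))

sumF-permute : ∀ m (f : Fin m → ℤ) (π : Permutation′ m) →
               sumF m f ≡ sumF m (λ i → f (π ⟨$⟩ʳ i))
sumF-permute m f π = trans (sumF≡sum m f)
  (trans (ℤSum.sum-permute f π) (sym (sumF≡sum m _)))

sumF-single : ∀ m (f : Fin m → ℤ) b → (∀ b′ → b ≢ b′ → f b′ ≡ + 0) → sumF m f ≡ f b
sumF-single (suc m) f zero    vanish = begin
  f zero + sumF m (λ i → f (suc i))  ≡⟨ cong (_+_ (f zero)) (sumF-zero m λ i → vanish (suc i) λ ()) ⟩
  f zero + + 0                       ≡⟨ ℤP.+-identityʳ (f zero) ⟩
  f zero                             ∎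
  where open ≡-Reasoning
sumF-single (suc m) f (suc b) vanish = begin
  f zero + sumF m (λ i → f (suc i))  ≡⟨ cong₂ _+_ (vanish zero λ ()) (sumF-single m _ b vanish′) ⟩
  + 0 + f (suc b)                    ≡⟨ ℤP.+-identityˡ (f (suc b)) ⟩
  f (suc b)                          ∎
  where
  open ≡-Reasoning
  vanish′ : ∀ b′ → b ≢ b′ → f (suc b′) ≡ + 0
  vanish′ b′ b≢b′ = vanish (suc b′) (λ eq → b≢b′ (FinP.suc-injective eq))

sumF-combine : ∀ m k (f : Fin (m * k) → ℤ) →
               sumF (m * k) f ≡ sumF m (λ b → sumF k (λ c → f (combine b c)))
sumF-combine zero    k f = refl
sumF-combine (suc m) k f = begin
  sumF (k +ℕ m * k) f
    ≡⟨ sumF-++ k (m * k) f ⟩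
  sumF k (λ c → f (c ↑ˡ m * k)) + sumF (m * k) (λ i → f (k ↑ʳ i))
    ≡⟨ cong (_+_ (sumF k (λ c → f (c ↑ˡ m * k)))) (sumF-combine m k (λ i → f (k ↑ʳ i))) ⟩
  sumF k (λ c → f (c ↑ˡ m * k)) + sumF m (λ b → sumF k (λ c → f (k ↑ʳ combine b c)))
    ∎
  where
  open ≡-Reasoning
  sumF-++ : ∀ a b (h : Fin (a +ℕ b) → ℤ) →
            sumF (a +ℕ b) h ≡ sumF a (λ i → h (i ↑ˡ b)) + sumF b (λ i → h (a ↑ʳ i))
  sumF-++ zero    b h = sym (ℤP.+-identityˡ _)
  sumF-++ (suc a) b h = trans (cong (_+_ (h zero)) (sumF-++ a b (λ i → h (suc i))))
                              (sym (ℤP.+-assoc (h zero) _ _))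

δ-diagonal : ∀ {m} (t : Fin m) → δ t t ≡ + 1
δ-diagonal t with t Fin.≟ t
... | yes _   = refl
... | no t≢t = ⊥-elim (t≢t refl)

δ-offDiagonal : ∀ {m} (t j : Fin m) → t ≢ j → δ t j ≡ + 0
δ-offDiagonal t j t≢j with t Fin.≟ j
... | yes t≡j = ⊥-elim (t≢j t≡j)
... | no _    = refl

Am-top : ∀ m (z : Fin (suc m) → ℤ) t → (Am (suc m) · z) (t ↑ˡ s m) ≡ z zero - z (suc t)
Am-top m z t rewrite FinP.splitAt-↑ˡ m t (s m) =
  cong₂ _+_ (ℤP.*-identityˡ (z zero)) (begin
    sumF m (λ j → - δ t j *ℤ z (suc j))
      ≡⟨ sumF-single m _ t (λ j t≢j → cong (λ d → - d *ℤ z (suc j)) (δ-offDiagonal t j t≢j)) ⟩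
    - δ t t *ℤ z (suc t)
      ≡⟨ cong (λ d → - d *ℤ z (suc t)) (δ-diagonal t) ⟩
    - + 1 *ℤ z (suc t)
      ≡⟨ ℤP.-1*i≡-i (z (suc t)) ⟩
    - z (suc t)
      ∎)
  where open ≡-Reasoning

Am-bottom : ∀ m (z : Fin (suc m) → ℤ) t → (Am (suc m) · z) (m ↑ʳ t) ≡ (Am m · (λ j → z (suc j))) t
Am-bottom m z t rewrite FinP.splitAt-↑ʳ m (s m) t = ℤP.+-identityˡ _

Am-nonzero⇒injective : ∀ m (z : Fin m → ℤ) → (Am m · z) <>0 → Injective _≡_ _≡_ z
Am-nonzero⇒injective (suc m) z nz {zero}  {zero}  _ = refl
Am-nonzero⇒injective (suc m) z nz {zero}  {suc t} z₀≡zₜ =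
  ⊥-elim (nz (t ↑ˡ s m) (trans (Am-top m z t) (trans (cong (_- z (suc t)) z₀≡zₜ) (ℤP.+-inverseʳ (z (suc t))))))
Am-nonzero⇒injective (suc m) z nz {suc t} {zero}  zₜ≡z₀ =
  sym (Am-nonzero⇒injective (suc m) z nz {zero} {suc t} (sym zₜ≡z₀))
Am-nonzero⇒injective (suc m) z nz {suc a} {suc b} za≡zb =
  cong suc (Am-nonzero⇒injective m (λ j → z (suc j)) (λ t → nz (m ↑ʳ t) ∘ trans (Am-bottom m z t)) za≡zb)

injective⇒Am-nonzero : ∀ m (z : Fin m → ℤ) → Injective _≡_ _≡_ z → (Am m · z) <>0
injective⇒Am-nonzero (suc m) z z-inj r = by-block (splitAt m r) refl
  where
  open ≡-Reasoning
  by-block : ∀ u → splitAt m r ≡ u → (Am (suc m) · z) r ≢ + 0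
  by-block (inj₁ t) split row≡0 = zero≢suc (z-inj (ℤP.i-j≡0⇒i≡j _ _ (begin
    z zero - z (suc t)          ≡⟨ Am-top m z t ⟨
    (Am (suc m) · z) (t ↑ˡ s m) ≡⟨ cong (Am (suc m) · z) (FinP.splitAt⁻¹-↑ˡ split) ⟩
    (Am (suc m) · z) r          ≡⟨ row≡0 ⟩
    + 0                         ∎)))
    where
    zero≢suc : zero ≢ suc t
    zero≢suc ()
  by-block (inj₂ t) split row≡0 =
    injective⇒Am-nonzero m (λ j → z (suc j)) (λ eq → FinP.suc-injective (z-inj eq)) t (begin
      (Am m · (λ j → z (suc j))) t ≡⟨ Am-bottom m z t ⟨
      (Am (suc m) · z) (m ↑ʳ t)   ≡⟨ cong (Am (suc m) · z) (FinP.splitAt⁻¹-↑ʳ split) ⟩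
      (Am (suc m) · z) r          ≡⟨ row≡0 ⟩
      + 0                         ∎)

-- Ablock is defined by a case split on the two block indices; blockEntry
-- names that split as a function of the coordinates, so that known
-- coordinates can be substituted into it.
blockEntry : ∀ n → Fin n × Fin (s n) → Fin n × Fin n → ℤ
blockEntry n (b , r) (b′ , c) with b Fin.≟ b′
... | yes _ = Am n r c
... | no _  = + 0

Ablock-entry : ∀ n r c → Ablock n r c ≡ blockEntry n (remQuot {n} (s n) r) (remQuot {n} n c)
Ablock-entry n r c with proj₁ (remQuot {n} (s n) r) Fin.≟ proj₁ (remQuot {n} n c)
... | yes _ = refl
... | no _  = refl

Ablock-combine : ∀ n (b b′ : Fin n) r c →
                 Ablock n (combine b r) (combine b′ c) ≡ blockEntry n (b , r) (b′ , c)
Ablock-combine n b b′ r c = trans (Ablock-entry n _ _)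
  (cong₂ (blockEntry n) (FinP.remQuot-combine b r) (FinP.remQuot-combine b′ c))

Ablock-diagonal : ∀ n (b : Fin n) r c → Ablock n (combine b r) (combine b c) ≡ Am n r c
Ablock-diagonal n b r c = trans (Ablock-combine n b b r c) diagonal
  where
  diagonal : blockEntry n (b , r) (b , c) ≡ Am n r c
  diagonal with b Fin.≟ b
  ... | yes _   = refl
  ... | no b≢b = ⊥-elim (b≢b refl)

Ablock-offDiagonal : ∀ n (b b′ : Fin n) r c → b ≢ b′ → Ablock n (combine b r) (combine b′ c) ≡ + 0
Ablock-offDiagonal n b b′ r c b≢b′ = trans (Ablock-combine n b b′ r c) offDiagonal
  where
  offDiagonal : blockEntry n (b , r) (b′ , c) ≡ + 0
  offDiagonal with b Fin.≟ b′
  ... | yes b≡b′ = ⊥-elim (b≢b′ b≡b′)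
  ... | no _     = refl

-- cell π j c is the c-th element of the j-th constraint set cs_π(j).
cell : ∀ {n} → Permutation′ (n * n) → Fin n → Fin n → Fin (n * n)
cell {n} π j c = π ⟨$⟩ʳ combine j c

-- Row (j, r) of A_π x is row r of A(n) applied to the entries of x on the
-- j-th constraint set: permuting the columns back, only block j survives.
Aπ-block : ∀ n (π : Permutation′ (n * n)) (x : Vector (n * n)) (j : Fin n) (r : Fin (s n)) →
           (Aπ n π · x) (combine j r) ≡ (Am n · (λ c → x (cell π j c))) r
Aπ-block n π x j r = begin
  sumF (n * n) (λ c → Ablock n R (π ⟨$⟩ˡ c) *ℤ x c)
    ≡⟨ sumF-permute (n * n) _ π ⟩
  sumF (n * n) (λ c → Ablock n R (π ⟨$⟩ˡ (π ⟨$⟩ʳ c)) *ℤ x (π ⟨$⟩ʳ c))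
    ≡⟨ sumF-cong (n * n) (λ c → cong (λ d → Ablock n R d *ℤ x (π ⟨$⟩ʳ c)) (inverseˡ π)) ⟩
  sumF (n * n) (λ c → Ablock n R c *ℤ x (π ⟨$⟩ʳ c))
    ≡⟨ sumF-combine n n _ ⟩
  sumF n (λ b → sumF n (λ c → Ablock n R (combine b c) *ℤ x (cell π b c)))
    ≡⟨ sumF-single n _ j (λ b j≢b → sumF-zero n (λ c →
         cong (_*ℤ x (cell π b c)) (Ablock-offDiagonal n j b r c j≢b))) ⟩
  sumF n (λ c → Ablock n R (combine j c) *ℤ x (cell π j c))
    ≡⟨ sumF-cong n (λ c → cong (_*ℤ x (cell π j c)) (Ablock-diagonal n j r c)) ⟩
  sumF n (λ c → Am n r c *ℤ x (cell π j c))
    ∎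
  where
  open ≡-Reasoning
  R : Fin (n * s n)
  R = combine j r

Aπ-nonzero⇒injective : ∀ n (π : Permutation′ (n * n)) (x : Vector (n * n)) → (Aπ n π · x) <>0 →
                       ∀ j → Injective _≡_ _≡_ (λ c → x (cell π j c))
Aπ-nonzero⇒injective n π x nz j =
  Am-nonzero⇒injective n _ (λ r → nz (combine j r) ∘ trans (Aπ-block n π x j r))

injective⇒Aπ-nonzero : ∀ n (π : Permutation′ (n * n)) (x : Vector (n * n)) →
                       (∀ j → Injective _≡_ _≡_ (λ c → x (cell π j c))) → (Aπ n π · x) <>0
injective⇒Aπ-nonzero n π x inj row row≡0 = injective⇒Am-nonzero n _ (inj j) r (begin
  (Am n · (λ c → x (cell π j c))) r ≡⟨ Aπ-block n π x j r ⟨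
  (Aπ n π · x) (combine j r)         ≡⟨ cong (Aπ n π · x) (FinP.combine-remQuot {n} (s n) row) ⟩
  (Aπ n π · x) row                   ≡⟨ row≡0 ⟩
  + 0                                ∎)
  where
  open ≡-Reasoning
  j : Fin n
  j = proj₁ (remQuot {n} (s n) row)
  r : Fin (s n)
  r = proj₂ (remQuot {n} (s n) row)

coords : ∀ {n} → Permutation′ (n * n) → Fin (n * n) → Fin n × Fin n
coords {n} π i = remQuot {n} n (π ⟨$⟩ˡ i)

cell-coords : ∀ {n} (π : Permutation′ (n * n)) i →
              cell π (proj₁ (coords {n} π i)) (proj₂ (coords {n} π i)) ≡ i
cell-coords {n} π i = trans (cong (π ⟨$⟩ʳ_) (FinP.combine-remQuot {n} n (π ⟨$⟩ˡ i))) (inverseʳ π)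

coords-cell : ∀ {n} (π : Permutation′ (n * n)) (j c : Fin n) → coords π (cell π j c) ≡ (j , c)
coords-cell π j c = trans (cong (remQuot _) (inverseˡ π)) (FinP.remQuot-combine j c)

cell-∈cs : ∀ {n} (π : Permutation′ (n * n)) (j c : Fin n) → cell π j c ∈cs[ π , j ]
cell-∈cs π j c = combine j c , cong proj₁ (FinP.remQuot-combine j c) , refl

∈cs⇒cell : ∀ {n} (π : Permutation′ (n * n)) (j : Fin n) i → i ∈cs[ π , j ] → ∃[ c ] (cell π j c ≡ i)
∈cs⇒cell {n} π j i (a , refl , refl) = proj₂ (remQuot {n} n a) , cong (π ⟨$⟩ʳ_) (FinP.combine-remQuot {n} n a)

∈cs-coords : ∀ {n} (π : Permutation′ (n * n)) i → i ∈cs[ π , proj₁ (coords {n} π i) ]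
∈cs-coords π i = π ⟨$⟩ˡ i , refl , inverseʳ π

injective-on-cs : ∀ n (π : Permutation′ (n * n)) (x : Vector (n * n)) → (Aπ n π · x) <>0 →
                  ∀ {j : Fin n} {i i′} → i ∈cs[ π , j ] → i′ ∈cs[ π , j ] → x i ≡ x i′ → i ≡ i′
injective-on-cs n π x nz {j} {i} {i′} i∈ i′∈ xi≡xi′ = begin
  i             ≡⟨ proj₂ at-i ⟨
  cell π j c    ≡⟨ cong (cell π j) (Aπ-nonzero⇒injective n π x nz j x-agrees) ⟩
  cell π j c′   ≡⟨ proj₂ at-i′ ⟩
  i′            ∎
  where
  open ≡-Reasoning
  at-i : ∃[ c ] (cell π j c ≡ i)
  at-i = ∈cs⇒cell π j i i∈
  at-i′ : ∃[ c ] (cell π j c ≡ i′)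
  at-i′ = ∈cs⇒cell π j i′ i′∈
  c c′ : Fin n
  c = proj₁ at-i
  c′ = proj₁ at-i′
  x-agrees : x (cell π j c) ≡ x (cell π j c′)
  x-agrees = trans (cong x (proj₂ at-i)) (trans xi≡xi′ (sym (cong x (proj₂ at-i′))))

Symbols : ∀ n → Vector (n * n) → Set
Symbols n x = ∀ i → Symbol n (x i)

Complete : ∀ n → Permutation′ (n * n) → Vector (n * n) → Set
Complete n π x = ∀ (j : Fin n) v → Symbol n v → ∃[ i ] (i ∈cs[ π , j ] × x i ≡ v)

nonzero⇒complete : ∀ n (π : Permutation′ (n * n)) (x : Vector (n * n)) → Symbols n x →
                   (Aπ n π · x) <>0 → Complete n π x
nonzero⇒complete n π x x-symbols nz j v v-symbol =
  cell π j c , cell-∈cs π j c , proj₂ covered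
  where
  covered : ∃[ c ] (x (cell π j c) ≡ v)
  covered = injective⇒covers (λ c → x-symbols _) (Aπ-nonzero⇒injective n π x nz j) v v-symbol
  c : Fin n
  c = proj₁ covered

complete⇒nonzero : ∀ n (π : Permutation′ (n * n)) (x : Vector (n * n)) → Symbols n x →
                   Complete n π x → (Aπ n π · x) <>0
complete⇒nonzero n π x x-symbols complete = injective⇒Aπ-nonzero n π x λ j →
  covers⇒injective (λ c → x-symbols _) (covers j)
  where
  covers : ∀ j → Covers n (λ c → x (cell π j c))
  covers j v v-symbol with complete j v v-symbol
  ... | i , i∈ , xi≡v with ∈cs⇒cell π j i i∈
  ...   | c , cell≡i = c , trans (cong x cell≡i) xi≡v

consistent⇒xConsistent : ∀ {n} (π τ : Permutation′ (n * n)) (x : Vector (n * n)) →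
                         πConsistent {n} π τ → πxConsistent {n} π x τ
consistent⇒xConsistent {n} π τ x consistent j v = mk⇔ to from
  where
  to : ∃[ i ] (i ∈cs[ π , j ] × x (τ ⟨$⟩ˡ i) ≡ v) → ∃[ i ] (i ∈cs[ π , j ] × x i ≡ v)
  to (i , i∈ , eq) with Equivalence.from (consistent j i) i∈
  ... | i′ , i′∈ , τi′≡i = i′ , i′∈ , trans (cong x τ⁻¹i≡i′) eq
    where
    τ⁻¹i≡i′ : i′ ≡ τ ⟨$⟩ˡ i
    τ⁻¹i≡i′ = trans (sym (inverseˡ τ)) (cong (τ ⟨$⟩ˡ_) τi′≡i)
  from : ∃[ i ] (i ∈cs[ π , j ] × x i ≡ v) → ∃[ i ] (i ∈cs[ π , j ] × x (τ ⟨$⟩ˡ i) ≡ v)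
  from (i , i∈ , eq) = τ ⟨$⟩ʳ i , Equivalence.to (consistent j _) (i , i∈ , refl) ,
                       trans (cong x (inverseˡ τ)) eq

xConsistent-complete : ∀ n (π τ : Permutation′ (n * n)) (x : Vector (n * n)) →
                       πxConsistent {n} π x τ → Complete n π x → Complete n π (actP τ x)
xConsistent-complete n π τ x consistent complete j v v-symbol =
  Equivalence.from (consistent j v) (complete j v v-symbol)

-- Conversely, if x and y = τ(x) are both complete, τ is π-x-consistent:
-- on each constraint set both take every symbol, and only symbols.
complete⇒xConsistent : ∀ n (π τ : Permutation′ (n * n)) (x y : Vector (n * n)) →
                       Symbols n x → (∀ i → actP τ x i ≡ y i) →
                       Complete n π x → Complete n π y → πxConsistent {n} π x τ
complete⇒xConsistent n π τ x y x-symbols relabels x-complete y-complete j v = mk⇔ to from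
  where
  to : ∃[ i ] (i ∈cs[ π , j ] × x (τ ⟨$⟩ˡ i) ≡ v) → ∃[ i ] (i ∈cs[ π , j ] × x i ≡ v)
  to (i , _ , eq) = x-complete j v (subst (Symbol n) eq (x-symbols _))
  from : ∃[ i ] (i ∈cs[ π , j ] × x i ≡ v) → ∃[ i ] (i ∈cs[ π , j ] × x (τ ⟨$⟩ˡ i) ≡ v)
  from (i , _ , eq) with y-complete j v (subst (Symbol n) eq (x-symbols i))
  ... | i′ , i′∈ , yi′≡v = i′ , i′∈ , trans (relabels i′) yi′≡v

matching : ∀ {n} (z w : Fin n → ℤ) → (∀ c → Symbol n (z c)) → (∀ c → Symbol n (w c)) →
           Injective _≡_ _≡_ z → Injective _≡_ _≡_ w → ∃[ σ ] (∀ c → z (σ ⟨$⟩ˡ c) ≡ w c)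
matching {n} z w z-symbols w-symbols z-inj w-inj =
  permutation to from to∘from from∘to , from-spec
  where
  to from : Fin n → Fin n
  to c = proj₁ (injective⇒covers w-symbols w-inj (z c) (z-symbols c))
  from c = proj₁ (injective⇒covers z-symbols z-inj (w c) (w-symbols c))
  to-spec : ∀ c → w (to c) ≡ z c
  to-spec c = proj₂ (injective⇒covers w-symbols w-inj (z c) (z-symbols c))
  from-spec : ∀ c → z (from c) ≡ w c
  from-spec c = proj₂ (injective⇒covers z-symbols z-inj (w c) (w-symbols c))
  to∘from : ∀ c → to (from c) ≡ c
  to∘from c = w-inj (trans (to-spec (from c)) (from-spec c))
  from∘to : ∀ c → from (to c) ≡ c
  from∘to c = z-inj (trans (from-spec (to c)) (to-spec c))

moveWithin : ∀ {n} → Permutation′ (n * n) → (Fin n → Fin n → Fin n) → Fin (n * n) → Fin (n * n)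
moveWithin {n} π f i = cell π j (f j c)
  where
  j c : Fin n
  j = proj₁ (coords {n} π i)
  c = proj₂ (coords {n} π i)

moveWithin-cell : ∀ {n} (π : Permutation′ (n * n)) f (j c : Fin n) →
                  moveWithin π f (cell π j c) ≡ cell π j (f j c)
moveWithin-cell π f j c = cong (λ p → cell π (proj₁ p) (f (proj₁ p) (proj₂ p))) (coords-cell π j c)

moveWithin-inverse : ∀ {n} (π : Permutation′ (n * n)) f g → (∀ j c → g j (f j c) ≡ c) →
                     ∀ i → moveWithin π g (moveWithin π f i) ≡ i
moveWithin-inverse {n} π f g g∘f≗id i = begin
  moveWithin π g (cell π j (f j c))   ≡⟨ moveWithin-cell π g j (f j c) ⟩
  cell π j (g j (f j c))              ≡⟨ cong (cell π j) (g∘f≗id j c) ⟩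
  cell π j c                          ≡⟨ cell-coords {n} π i ⟩
  i                                   ∎
  where
  open ≡-Reasoning
  j c : Fin n
  j = proj₁ (coords {n} π i)
  c = proj₂ (coords {n} π i)

withinBlocks : ∀ {n} → Permutation′ (n * n) → (Fin n → Permutation′ n) → Permutation′ (n * n)
withinBlocks {n} π σ = permutation (moveWithin π forward) (moveWithin π backward)
  (moveWithin-inverse π backward forward (λ j c → inverseʳ (σ j)))
  (moveWithin-inverse π forward backward (λ j c → inverseˡ (σ j)))
  where
  forward backward : Fin n → Fin n → Fin n
  forward j = σ j ⟨$⟩ʳ_
  backward j = σ j ⟨$⟩ˡ_

withinBlocks-consistent : ∀ {n} (π : Permutation′ (n * n)) σ → πConsistent {n} π (withinBlocks π σ)
withinBlocks-consistent {n} π σ j y = mk⇔ to from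
  where
  τ : Permutation′ (n * n)
  τ = withinBlocks π σ
  to : ∃[ i ] (i ∈cs[ π , j ] × τ ⟨$⟩ʳ i ≡ y) → y ∈cs[ π , j ]
  to (i , i∈ , τi≡y) with ∈cs⇒cell π j i i∈
  ... | c , refl = subst (_∈cs[ π , j ])
                         (trans (sym (moveWithin-cell π (λ j → σ j ⟨$⟩ʳ_) j c)) τi≡y)
                         (cell-∈cs π j (σ j ⟨$⟩ʳ c))
  from : y ∈cs[ π , j ] → ∃[ i ] (i ∈cs[ π , j ] × τ ⟨$⟩ʳ i ≡ y)
  from y∈ with ∈cs⇒cell π j y y∈
  ... | c , refl = cell π j (σ j ⟨$⟩ˡ c) , cell-∈cs π j _ ,
                   trans (moveWithin-cell π (λ j → σ j ⟨$⟩ʳ_) j _) (cong (cell π j) (inverseʳ (σ j)))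

-- Two vectors of symbols satisfying the π-constraints differ by a
-- π-consistent permutation: rearrange each constraint set separately.
relabelling : ∀ n (π : Permutation′ (n * n)) (x y : Vector (n * n)) → Symbols n x → Symbols n y →
              (Aπ n π · x) <>0 → (Aπ n π · y) <>0 →
              ∃[ τ ] (πConsistent {n} π τ × ∀ i → actP τ x i ≡ y i)
relabelling n π x y x-symbols y-symbols x-nz y-nz = τ , withinBlocks-consistent π σ , relabels
  where
  matches : ∀ j → ∃[ σ ] (∀ c → x (cell π j (σ ⟨$⟩ˡ c)) ≡ y (cell π j c))
  matches j = matching _ _ (λ c → x-symbols _) (λ c → y-symbols _)
    (Aπ-nonzero⇒injective n π x x-nz j) (Aπ-nonzero⇒injective n π y y-nz j)
  σ : Fin n → Permutation′ n
  σ j = proj₁ (matches j)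
  τ : Permutation′ (n * n)
  τ = withinBlocks π σ
  relabels : ∀ i → actP τ x i ≡ y i
  relabels i = begin
    x (τ ⟨$⟩ˡ i)                ≡⟨ cong (λ i′ → x (τ ⟨$⟩ˡ i′)) (cell-coords {n} π i) ⟨
    x (τ ⟨$⟩ˡ cell π j c)       ≡⟨ cong x (moveWithin-cell π (λ j → σ j ⟨$⟩ˡ_) j c) ⟩
    x (cell π j (σ j ⟨$⟩ˡ c))   ≡⟨ proj₂ (matches j) c ⟩
    y (cell π j c)              ≡⟨ cong y (cell-coords {n} π i) ⟩
    y i                         ∎
    where
    open ≡-Reasoning
    j c : Fin n
    j = proj₁ (coords {n} π i)
    c = proj₂ (coords {n} π i)

-- A π-consistent permutation fixes every cell whose entry it does not change,
-- provided x is injective on the constraint sets of π: the preimage of the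
-- cell lies in the same constraint set and carries the same entry.
consistent-fixes : ∀ n (π τ : Permutation′ (n * n)) (x : Vector (n * n)) → πConsistent {n} π τ →
                   (Aπ n π · x) <>0 → ∀ i → actP τ x i ≡ x i → τ ⟨$⟩ʳ i ≡ i
consistent-fixes n π τ x consistent nz i unchanged
  with Equivalence.from (consistent (proj₁ (coords {n} π i)) i) (∈cs-coords π i)
... | i′ , i′∈ , τi′≡i = trans (cong (τ ⟨$⟩ʳ_) (sym i′≡i)) τi′≡i
  where
  τ⁻¹i≡i′ : τ ⟨$⟩ˡ i ≡ i′
  τ⁻¹i≡i′ = trans (cong (τ ⟨$⟩ˡ_) (sym τi′≡i)) (inverseˡ τ)
  i′≡i : i′ ≡ i
  i′≡i = injective-on-cs n π x nz i′∈ (∈cs-coords π i) (trans (cong x (sym τ⁻¹i≡i′)) unchanged)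

module Sudoku {n} (π₁ π₂ π₃ : Permutation′ (n * n)) {k} (ι : Fin k → Fin (n * n)) (g : Fin k → ℤ) where

  Solution : Vector (n * n) → Set
  Solution = InS n π₁ π₂ π₃ k ι g

  Symmetry : Vector (n * n) → Permutation′ (n * n) → Set
  Symmetry x τ = πConsistent {n} π₁ τ × πxConsistent {n} π₂ x τ × πxConsistent {n} π₃ x τ ×
                 (∀ l → τ ⟨$⟩ʳ (ι l) ≡ ι l)

  permuted-solution : ∀ {x} τ → Solution x → Symmetry x τ → Solution (actP τ x)
  permuted-solution {x} τ (x-symbols , nz₁ , nz₂ , nz₃ , givens) (c₁ , c₂ , c₃ , fixes) =
    (λ i → x-symbols (τ ⟨$⟩ˡ i)) , preserved π₁ nz₁ (consistent⇒xConsistent π₁ τ x c₁) ,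
    preserved π₂ nz₂ c₂ , preserved π₃ nz₃ c₃ , keeps-givens
    where
    preserved : ∀ (π : Permutation′ (n * n)) → (Aπ n π · x) <>0 → πxConsistent {n} π x τ →
                (Aπ n π · actP τ x) <>0
    preserved π nz consistent = complete⇒nonzero n π (actP τ x) (λ i → x-symbols (τ ⟨$⟩ˡ i))
      (xConsistent-complete n π τ x consistent (nonzero⇒complete n π x x-symbols nz))
    keeps-givens : ∀ l → x (τ ⟨$⟩ˡ ι l) ≡ g l
    keeps-givens l = trans (cong x (trans (cong (τ ⟨$⟩ˡ_) (sym (fixes l))) (inverseˡ τ))) (givens l)

  solution-relabelling : ∀ {x y} → Solution x → Solution y →
                         ∃[ τ ] (Symmetry x τ × ∀ i → actP τ x i ≡ y i)
  solution-relabelling {x} {y} (x-symbols , x₁ , x₂ , x₃ , x-givens)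
                               (y-symbols , y₁ , y₂ , y₃ , y-givens) =
    τ , (c₁ , consistent π₂ x₂ y₂ , consistent π₃ x₃ y₃ , fixes) , relabels
    where
    relabelled : ∃[ τ ] (πConsistent {n} π₁ τ × ∀ i → actP τ x i ≡ y i)
    relabelled = relabelling n π₁ x y x-symbols y-symbols x₁ y₁
    τ : Permutation′ (n * n)
    τ = proj₁ relabelled
    c₁ : πConsistent {n} π₁ τ
    c₁ = proj₁ (proj₂ relabelled)
    relabels : ∀ i → actP τ x i ≡ y i
    relabels = proj₂ (proj₂ relabelled)
    consistent : ∀ (π : Permutation′ (n * n)) → (Aπ n π · x) <>0 → (Aπ n π · y) <>0 →
                 πxConsistent {n} π x τ
    consistent π x-nz y-nz = complete⇒xConsistent n π τ x y x-symbols relabels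
      (nonzero⇒complete n π x x-symbols x-nz) (nonzero⇒complete n π y y-symbols y-nz)
    fixes : ∀ l → τ ⟨$⟩ʳ (ι l) ≡ ι l
    fixes l = consistent-fixes n π₁ τ x c₁ x₁ (ι l)
      (trans (relabels (ι l)) (trans (y-givens l) (sym (x-givens l))))

-- A symmetry moving x would produce a second solution τ(x); conversely a
-- second solution y ≠ x is τ(x) for a symmetry τ, which then moves x.
theorem4p3 : (n : ℕ) → 2 ≤ n →
    (π₁ π₂ π₃ : Permutation′ (n * n)) (k : ℕ) →
    (ι : Fin k → Fin (n * n)) → Injective _≡_ _≡_ ι →
    (g : Fin k → ℤ) → (∀ l → (+ 1 ≤ℤ g l) × (g l ≤ℤ + n)) →
    (x : Fin (n * n) → ℤ) → InS n π₁ π₂ π₃ k ι g x →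
    (∀ y → InS n π₁ π₂ π₃ k ι g y → ∀ i → y i ≡ x i)
      ⇔ (¬ (∃[ τ ] ((¬ (∀ i → actP τ x i ≡ x i)) ×
                    πConsistent {n} π₁ τ ×
                    πxConsistent {n} π₂ x τ ×
                    πxConsistent {n} π₃ x τ ×
                    (∀ l → τ ⟨$⟩ʳ (ι l) ≡ ι l))))
theorem4p3 n _ π₁ π₂ π₃ k ι _ g _ x x-solution = mk⇔ unique⇒rigid rigid⇒unique
  where
  open Sudoku {n} π₁ π₂ π₃ ι g
  Moves : Permutation′ (n * n) → Set
  Moves τ = ¬ (∀ i → actP τ x i ≡ x i)
  Unique Rigid : Set
  Unique = ∀ y → Solution y → ∀ i → y i ≡ x i
  Rigid = ¬ (∃[ τ ] (Moves τ × Symmetry x τ))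

  unique⇒rigid : Unique → Rigid
  unique⇒rigid unique (τ , moves , symmetry) =
    moves (unique (actP τ x) (permuted-solution τ x-solution symmetry))

  rigid⇒unique : Rigid → Unique
  rigid⇒unique rigid y y-solution i = decidable-stable (y i ℤ.≟ x i) λ yi≢xi →
    let (τ , symmetry , relabels) = solution-relabelling x-solution y-solution
    in rigid (τ , (λ fixes-x → yi≢xi (trans (sym (relabels i)) (fixes-x i))) , symmetry)
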